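{- Let $k\ge1$ and $n,p\ge0$ be integers. The number of words $\pi\in[2k]^n$ with $\overleftarrow{\mathrm{des}}_O(\pi)=p$, which also equals the number of words $\pi\in[2k]^n$ with $\overleftarrow{\mathrm{ris}}_E(\pi)=p$, is $$\sum_{j=0}^n\sum_{i=0}^j(-1)^{n+p+i}2^j\binom{j}{i}\binom{ki}{n}\binom{n-j}{p}.$$
   Context: $[N]=\{1,\ldots,N\}$, $[N]^n$ is the set of words of length $n$ over $[N]$. $E=\{2,4,6,\ldots\}$, $O=\{1,3,5,\ldots\}$. For a word $\pi=\pi_1\cdots\pi_n$ and $X\subseteq\mathbb{N}$, $\overleftarrow{\mathrm{des}}_X(\pi)=|\{i:\pi_i>\pi_{i+1},\ \pi_i\in X\}|$ and $\overleftarrow{\mathrm{ris}}_X(\pi)=|\{i:\pi_i<\pi_{i+1},\ \pi_i\in X\}|$. Convention: $\binom{a}{b}=0$ if $b<0$ or $b>a$ (for $a\ge0$). -}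

module Defs where

open import Data.Nat using (ℕ; zero; suc; _+_; _*_; _∸_; _^_; _<ᵇ_)
open import Data.Nat.Combinatorics using (_C_)
open import Data.Bool using (Bool; true; false; _∧_; if_then_else_)
open import Data.Fin using (Fin; toℕ)
open import Data.Vec using (Vec; []; _∷_)
open import Data.List using (List; []; _∷_; concatMap; map; filterᵇ; length; allFin; upTo)
open import Data.Integer using (ℤ; +_; -_; _*_; _+_)
open import Data.Nat using (_≡ᵇ_)

even : ℕ → Bool
even zero = true
even (suc m) = odd' m
  where
  odd' : ℕ → Bool
  odd' zero = false
  odd' (suc m) = even m

odd : ℕ → Bool
odd m = even (suc m)

-- All words of length n over the alphabet [N]; a letter x : Fin N stands for the
-- integer toℕ x + 1 ∈ {1,…,N}.
words : (N n : ℕ) → List (Vec (Fin N) n)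
words N zero    = [] ∷ []
words N (suc n) = concatMap (λ x → map (x ∷_) (words N n)) (allFin N)

val : {N : ℕ} → Fin N → ℕ
val x = suc (toℕ x)

desX : (ℕ → Bool) → {N n : ℕ} → Vec (Fin N) n → ℕ
desX X []               = 0
desX X (a ∷ [])         = 0
desX X (a ∷ b ∷ w) =
  (if (val b <ᵇ val a) ∧ X (val a) then 1 else 0) Data.Nat.+ desX X (b ∷ w)

risX : (ℕ → Bool) → {N n : ℕ} → Vec (Fin N) n → ℕ
risX X []               = 0
risX X (a ∷ [])         = 0
risX X (a ∷ b ∷ w) =
  (if (val a <ᵇ val b) ∧ X (val a) then 1 else 0) Data.Nat.+ risX X (b ∷ w)

-- O = odd positive integers, E = even positive integers (letters are always ≥ 1)
isO : ℕ → Bool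
isO = odd

isE : ℕ → Bool
isE = even

countWords : (N n : ℕ) → ({N n : ℕ} → Vec (Fin N) n → ℕ) → ℕ → ℕ
countWords N n st p = length (filterᵇ (λ w → st w ≡ᵇ p) (words N n))

sign : ℕ → ℤ
sign m = if even m then + 1 else - (+ 1)

sumTo : ℕ → (ℕ → ℤ) → ℤ
sumTo zero    f = f 0
sumTo (suc m) f = sumTo m f Data.Integer.+ f (suc m)

formula : (k n p : ℕ) → ℤ
formula k n p =
  sumTo n (λ j → sumTo j (λ i →
    sign (n Data.Nat.+ p Data.Nat.+ i) Data.Integer.*
    + (2 ^ j Data.Nat.* (j C i) Data.Nat.* ((k Data.Nat.* i) C n) Data.Nat.* ((n ∸ j) C p))))

-- Write d w for the number of descents of w at odd letters. By binomial inversion the number of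
-- words with d w = p is Σ_q (-1)^(q+p) C(q,p) M_q, where the binomial moment M_q = Σ_w C(d w, q)
-- counts words with q marked descents. Marked descents chain into runs a₀ > a₁ > ⋯ > aᵣ whose
-- letters other than the last are odd; there are 2 C(k, r+1) runs with r descents, so a word of
-- length j + q with q marked descents is a sequence of j runs, and M_q = 2^j [x^q] P(x)^j where
-- x P(x) = (1+x)^k - 1 (proved by recursion on the first letter). Inverting
-- (1+x)^(ki) = Σ_j C(i,j) (x P(x))^j gives [x^q] P(x)^j = Σ_i (-1)^(j+i) C(j,i) C(ki, j+q), and
-- writing q = n - j yields the formula. Complementing letters, a ↦ 2k+1-a, reverses
-- comparisons and exchanges odd and even letters, so it carries des_O to ris_E.
module Submission where

open import Data.Nat.Base using (ℕ)

module Binomial where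

  open import Data.Bool.Base using (Bool; true; false)
  open import Data.Nat.Base
  open import Data.Nat.Properties using (m<n⇒m<1+n)
  open import Data.Nat.Combinatorics using (_C_; nCk+nC[k+1]≡[n+1]C[k+1])
  open import Function.Base using (_∘_)
  open import Relation.Binary.PropositionalEquality
  open import Relation.Nullary.Negation using (contradiction)

  iverson : Bool → ℕ
  iverson true  = 1
  iverson false = 0

  δ : ℕ → ℕ → ℕ
  δ m n = iverson (m ≡ᵇ n)

  δ-refl : ∀ n → δ n n ≡ 1
  δ-refl zero    = refl
  δ-refl (suc n) = δ-refl n

  m≢n⇒δ≡0 : ∀ {m n} → m ≢ n → δ m n ≡ 0
  m≢n⇒δ≡0 {zero}  {zero}  m≢n = contradiction refl m≢n
  m≢n⇒δ≡0 {zero}  {suc n} m≢n = refl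
  m≢n⇒δ≡0 {suc m} {zero}  m≢n = refl
  m≢n⇒δ≡0 {suc m} {suc n} m≢n = m≢n⇒δ≡0 (m≢n ∘ cong suc)

  -- Pascal's rule holds definitionally, unlike for the library's n C k.
  binom : ℕ → ℕ → ℕ
  binom n       zero    = 1
  binom zero    (suc k) = 0
  binom (suc n) (suc k) = binom n k + binom n (suc k)

  binom≡C : ∀ n k → binom n k ≡ n C k
  binom≡C n       zero    = refl
  binom≡C zero    (suc k) = refl
  binom≡C (suc n) (suc k) =
    trans (cong₂ _+_ (binom≡C n k) (binom≡C n (suc k))) (nCk+nC[k+1]≡[n+1]C[k+1] n k)

  n<k⇒binom≡0 : ∀ {n k} → n < k → binom n k ≡ 0
  n<k⇒binom≡0 {zero}  {suc k} _         = refl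
  n<k⇒binom≡0 {suc n} {suc k} (s≤s n<k) = cong₂ _+_ (n<k⇒binom≡0 n<k) (n<k⇒binom≡0 (m<n⇒m<1+n n<k))

module Convolution where

  open import Data.Nat.Base
  open import Data.Nat.Properties
  open import Function.Base using (_∘_)
  open import Relation.Binary.PropositionalEquality
  open import Algebra.Properties.CommutativeSemigroup +-commutativeSemigroup as +
    using (interchange)
  open import Algebra.Properties.CommutativeSemigroup *-commutativeSemigroup as *
    using ()
  open Binomial

  infixl 7 _⋆_

  -- Cauchy product of coefficient sequences: (f ⋆ g) n = Σ_{r ≤ n} f r * g (n ∸ r).
  _⋆_ : (ℕ → ℕ) → (ℕ → ℕ) → ℕ → ℕ
  (f ⋆ g) zero    = f 0 * g 0
  (f ⋆ g) (suc n) = f 0 * g (suc n) + (f ∘ suc ⋆ g) n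

  ⋆-cong : ∀ {f f′ g g′} → f ≗ f′ → g ≗ g′ → f ⋆ g ≗ f′ ⋆ g′
  ⋆-cong f≗f′ g≗g′ zero    = cong₂ _*_ (f≗f′ 0) (g≗g′ 0)
  ⋆-cong f≗f′ g≗g′ (suc n) =
    cong₂ _+_ (cong₂ _*_ (f≗f′ 0) (g≗g′ (suc n))) (⋆-cong (f≗f′ ∘ suc) g≗g′ n)

  ⋆-zeroˡ : ∀ {f} g → (∀ r → f r ≡ 0) → ∀ n → (f ⋆ g) n ≡ 0
  ⋆-zeroˡ g f≡0 zero    rewrite f≡0 0 = refl
  ⋆-zeroˡ g f≡0 (suc n) rewrite f≡0 0 = ⋆-zeroˡ g (f≡0 ∘ suc) n

  ⋆-distribʳ-+ : ∀ f f′ g n → ((λ r → f r + f′ r) ⋆ g) n ≡ (f ⋆ g) n + (f′ ⋆ g) n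
  ⋆-distribʳ-+ f f′ g zero    = *-distribʳ-+ (g 0) (f 0) (f′ 0)
  ⋆-distribʳ-+ f f′ g (suc n) = trans
    (cong₂ _+_ (*-distribʳ-+ (g (suc n)) (f 0) (f′ 0)) (⋆-distribʳ-+ (f ∘ suc) (f′ ∘ suc) g n))
    (interchange (f 0 * g (suc n)) _ ((f ∘ suc ⋆ g) n) _)

  ⋆-distribˡ-+ : ∀ f g g′ n → (f ⋆ (λ m → g m + g′ m)) n ≡ (f ⋆ g) n + (f ⋆ g′) n
  ⋆-distribˡ-+ f g g′ zero    = *-distribˡ-+ (f 0) (g 0) (g′ 0)
  ⋆-distribˡ-+ f g g′ (suc n) = trans
    (cong₂ _+_ (*-distribˡ-+ (f 0) (g (suc n)) (g′ (suc n))) (⋆-distribˡ-+ (f ∘ suc) g g′ n))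
    (interchange (f 0 * g (suc n)) _ ((f ∘ suc ⋆ g) n) _)

  ⋆-*ˡ : ∀ c f g n → ((λ r → c * f r) ⋆ g) n ≡ c * (f ⋆ g) n
  ⋆-*ˡ c f g zero    = *-assoc c (f 0) (g 0)
  ⋆-*ˡ c f g (suc n) = trans
    (cong₂ _+_ (*-assoc c (f 0) (g (suc n))) (⋆-*ˡ c (f ∘ suc) g n))
    (sym (*-distribˡ-+ c _ _))

  ⋆-*ʳ : ∀ c f g n → (f ⋆ (λ m → c * g m)) n ≡ c * (f ⋆ g) n
  ⋆-*ʳ c f g zero    = *.x∙yz≈y∙xz (f 0) c (g 0)
  ⋆-*ʳ c f g (suc n) = trans
    (cong₂ _+_ (*.x∙yz≈y∙xz (f 0) c (g (suc n))) (⋆-*ʳ c (f ∘ suc) g n))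
    (sym (*-distribˡ-+ c _ _))

  shift : (ℕ → ℕ) → ℕ → ℕ
  shift g zero    = 0
  shift g (suc m) = g m

  ⋆-shift : ∀ f g n → (f ⋆ shift g) (suc n) ≡ (f ⋆ g) n
  ⋆-shift f g zero    = trans (cong (f 0 * g 0 +_) (*-zeroʳ (f 1))) (+-identityʳ _)
  ⋆-shift f g (suc n) = cong (f 0 * g (suc n) +_) (⋆-shift (f ∘ suc) g n)

  vandermonde : ∀ a b n → binom (a + b) n ≡ (binom a ⋆ binom b) n
  vandermonde zero    b zero    = refl
  vandermonde zero    b (suc n) = sym (trans
    (cong₂ _+_ (*-identityˡ (binom b (suc n))) (⋆-zeroˡ (binom b) (λ _ → refl) n))
    (+-identityʳ _))
  vandermonde (suc a) b zero    = refl
  vandermonde (suc a) b (suc n) = begin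
      binom (a + b) n + binom (a + b) (suc n)
    ≡⟨ cong₂ _+_ (vandermonde a b n) (vandermonde a b (suc n)) ⟩
      (binom a ⋆ binom b) n + (1 * binom b (suc n) + (binom a ∘ suc ⋆ binom b) n)
    ≡⟨ +.x∙yz≈y∙xz ((binom a ⋆ binom b) n) (1 * binom b (suc n)) _ ⟩
      1 * binom b (suc n) + ((binom a ⋆ binom b) n + (binom a ∘ suc ⋆ binom b) n)
    ≡⟨ cong (1 * binom b (suc n) +_) (⋆-distribʳ-+ (binom a) (binom a ∘ suc) (binom b) n) ⟨
      (binom (suc a) ⋆ binom b) (suc n)
    ∎
    where open ≡-Reasoning

  -- diagConv f g n = Σ_{j ≤ n} f j * g j (n ∸ j), the coefficient of xⁿ in Σ_j f j xʲ G_j(x).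
  diagConv : (ℕ → ℕ) → (ℕ → ℕ → ℕ) → ℕ → ℕ
  diagConv f g zero    = f 0 * g 0 0
  diagConv f g (suc n) = f 0 * g 0 (suc n) + diagConv (f ∘ suc) (g ∘ suc) n

  diagConv-zeroˡ : ∀ {f} g → (∀ j → f j ≡ 0) → ∀ n → diagConv f g n ≡ 0
  diagConv-zeroˡ g f≡0 zero    rewrite f≡0 0 = refl
  diagConv-zeroˡ g f≡0 (suc n) rewrite f≡0 0 = diagConv-zeroˡ (g ∘ suc) (f≡0 ∘ suc) n

  diagConv-distribʳ-+ : ∀ f f′ g n →
    diagConv (λ j → f j + f′ j) g n ≡ diagConv f g n + diagConv f′ g n
  diagConv-distribʳ-+ f f′ g zero    = *-distribʳ-+ (g 0 0) (f 0) (f′ 0)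
  diagConv-distribʳ-+ f f′ g (suc n) = trans
    (cong₂ _+_ (*-distribʳ-+ (g 0 (suc n)) (f 0) (f′ 0))
               (diagConv-distribʳ-+ (f ∘ suc) (f′ ∘ suc) (g ∘ suc) n))
    (interchange (f 0 * g 0 (suc n)) _ (diagConv (f ∘ suc) (g ∘ suc) n) _)

  diagConv-unroll : ∀ f g →
    diagConv f g ≗ λ m → f 0 * g 0 m + shift (diagConv (f ∘ suc) (g ∘ suc)) m
  diagConv-unroll f g zero    = sym (+-identityʳ _)
  diagConv-unroll f g (suc m) = refl

  diagConv-⋆ : ∀ f g h n → diagConv f (λ j → h ⋆ g j) n ≡ (h ⋆ diagConv f g) n
  diagConv-⋆ f g h zero    = *.x∙yz≈y∙xz (f 0) (h 0) (g 0 0)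
  diagConv-⋆ f g h (suc m) = begin
      f 0 * (h ⋆ g 0) (suc m) + diagConv (f ∘ suc) (λ j → h ⋆ g (suc j)) m
    ≡⟨ cong₂ _+_ (sym (⋆-*ʳ (f 0) h (g 0) (suc m))) (diagConv-⋆ (f ∘ suc) (g ∘ suc) h m) ⟩
      (h ⋆ (λ i → f 0 * g 0 i)) (suc m) + (h ⋆ rest) m
    ≡⟨ cong ((h ⋆ (λ i → f 0 * g 0 i)) (suc m) +_) (⋆-shift h rest m) ⟨
      (h ⋆ (λ i → f 0 * g 0 i)) (suc m) + (h ⋆ shift rest) (suc m)
    ≡⟨ ⋆-distribˡ-+ h (λ i → f 0 * g 0 i) (shift rest) (suc m) ⟨
      (h ⋆ (λ i → f 0 * g 0 i + shift rest i)) (suc m)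
    ≡⟨ ⋆-cong {f = h} (λ _ → refl) (diagConv-unroll f g) (suc m) ⟨
      (h ⋆ diagConv f g) (suc m)
    ∎
    where
    open ≡-Reasoning
    rest = diagConv (f ∘ suc) (g ∘ suc)

  -- binom 0 is the unit of ⋆.
  convPow : (ℕ → ℕ) → ℕ → ℕ → ℕ
  convPow f zero    = binom 0
  convPow f (suc j) = f ⋆ convPow f j

  convPow-* : ∀ c f j q → convPow (λ r → c * f r) j q ≡ c ^ j * convPow f j q
  convPow-* c f zero    q = sym (*-identityˡ _)
  convPow-* c f (suc j) q = begin
      ((λ r → c * f r) ⋆ convPow (λ r → c * f r) j) q
    ≡⟨ ⋆-cong {f = λ r → c * f r} (λ _ → refl) (convPow-* c f j) q ⟩
      ((λ r → c * f r) ⋆ (λ m → c ^ j * convPow f j m)) q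
    ≡⟨ ⋆-*ˡ c f _ q ⟩
      c * (f ⋆ (λ m → c ^ j * convPow f j m)) q
    ≡⟨ cong (c *_) (⋆-*ʳ (c ^ j) f (convPow f j) q) ⟩
      c * (c ^ j * (f ⋆ convPow f j) q)
    ≡⟨ *-assoc c (c ^ j) _ ⟨
      c ^ suc j * convPow f (suc j) q
    ∎
    where open ≡-Reasoning

  diagConv-binom-zero : ∀ g n → diagConv (binom 0) g n ≡ g 0 n
  diagConv-binom-zero g zero    = *-identityˡ (g 0 0)
  diagConv-binom-zero g (suc n) = trans
    (cong₂ _+_ (*-identityˡ (g 0 (suc n))) (diagConv-zeroˡ (g ∘ suc) (λ _ → refl) n))
    (+-identityʳ (g 0 (suc n)))

  -- With P r = binom k (1 + r), so that x P(x) = (1 + x)ᵏ - 1, the next two lemmas say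
  -- (1 + x)^(k i) = (1 + x P(x))ⁱ = Σ_j binom i j xʲ P(x)ʲ.
  diagConv-binom-suc : ∀ k i n →
    diagConv (binom (suc i)) (convPow (binom k ∘ suc)) n
      ≡ (binom k ⋆ diagConv (binom i) (convPow (binom k ∘ suc))) n
  diagConv-binom-suc k i zero    = refl
  diagConv-binom-suc k i (suc m) = begin
      1 * S 0 (suc m) + diagConv (λ j → binom i j + binom i (suc j)) (S ∘ suc) m
    ≡⟨ cong (1 * S 0 (suc m) +_) (diagConv-distribʳ-+ (binom i) (binom i ∘ suc) (S ∘ suc) m) ⟩
      1 * S 0 (suc m) + (diagConv (binom i) (S ∘ suc) m + diagConv (binom i ∘ suc) (S ∘ suc) m)
    ≡⟨ cong (λ x → 1 * S 0 (suc m) + (x + diagConv (binom i ∘ suc) (S ∘ suc) m))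
            (diagConv-⋆ (binom i) S (binom k ∘ suc) m) ⟩
      1 * S 0 (suc m) + ((binom k ∘ suc ⋆ X) m + diagConv (binom i ∘ suc) (S ∘ suc) m)
    ≡⟨ +.x∙yz≈xz∙y (1 * S 0 (suc m)) ((binom k ∘ suc ⋆ X) m) _ ⟩
      X (suc m) + (binom k ∘ suc ⋆ X) m
    ≡⟨ cong (_+ (binom k ∘ suc ⋆ X) m) (*-identityˡ (X (suc m))) ⟨
      (binom k ⋆ X) (suc m)
    ∎
    where
    open ≡-Reasoning
    S = convPow (binom k ∘ suc)
    X = diagConv (binom i) S

  binom[k*i]≡diagConv : ∀ k i n →
    binom (k * i) n ≡ diagConv (binom i) (convPow (binom k ∘ suc)) n
  binom[k*i]≡diagConv k zero    n =
    trans (cong (λ m → binom m n) (*-zeroʳ k)) (sym (diagConv-binom-zero (convPow (binom k ∘ suc)) n))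
  binom[k*i]≡diagConv k (suc i) n = begin
      binom (k * suc i) n
    ≡⟨ cong (λ m → binom m n) (*-suc k i) ⟩
      binom (k + k * i) n
    ≡⟨ vandermonde k (k * i) n ⟩
      (binom k ⋆ binom (k * i)) n
    ≡⟨ ⋆-cong {f = binom k} (λ _ → refl) (binom[k*i]≡diagConv k i) n ⟩
      (binom k ⋆ diagConv (binom i) (convPow (binom k ∘ suc))) n
    ≡⟨ diagConv-binom-suc k i n ⟨
      diagConv (binom (suc i)) (convPow (binom k ∘ suc)) n
    ∎
    where open ≡-Reasoning

module AlternatingSums where

  open import Data.Nat.Base as ℕ using (ℕ; zero; suc; _≤_; _<_; z≤n; s≤s; _∸_)
  import Data.Nat.Properties as ℕ
  open import Data.Integer.Base using (ℤ; +_; -_; _+_; _*_)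
  open import Data.Integer.Properties
  open import Data.Integer.Tactic.RingSolver using (solve-∀)
  open import Data.Sum.Base using (inj₁; inj₂)
  open import Function.Base using (_∘_)
  open import Relation.Binary.PropositionalEquality
  open import Algebra.Properties.CommutativeSemigroup +-commutativeSemigroup
    using (interchange; x∙yz≈y∙xz)
  open import Defs using (sign; sumTo)
  open Binomial
  open Convolution using (diagConv)

  sign-suc : ∀ m → sign (suc m) ≡ - sign m
  sign-suc zero    = refl
  sign-suc (suc m) = sym (trans (cong -_ (sign-suc m)) (neg-involutive (sign m)))

  sign-+ : ∀ m n → sign (m ℕ.+ n) ≡ sign m * sign n
  sign-+ zero    n = sym (*-identityˡ (sign n))
  sign-+ (suc m) n = begin
      sign (suc (m ℕ.+ n))   ≡⟨ sign-suc (m ℕ.+ n) ⟩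
      - sign (m ℕ.+ n)       ≡⟨ cong -_ (sign-+ m n) ⟩
      - (sign m * sign n)    ≡⟨ neg-distribˡ-* (sign m) (sign n) ⟩
      - sign m * sign n      ≡⟨ cong (_* sign n) (sign-suc m) ⟨
      sign (suc m) * sign n  ∎
    where open ≡-Reasoning

  sign-square : ∀ m → sign m * sign m ≡ + 1
  sign-square zero    = refl
  sign-square (suc m) = begin
      sign (suc m) * sign (suc m)  ≡⟨ cong₂ _*_ (sign-suc m) (sign-suc m) ⟩
      - sign m * - sign m          ≡⟨ neg-distribˡ-* (sign m) (- sign m) ⟨
      - (sign m * - sign m)        ≡⟨ cong -_ (neg-distribʳ-* (sign m) (sign m)) ⟨
      - - (sign m * sign m)        ≡⟨ neg-involutive _ ⟩
      sign m * sign m              ≡⟨ sign-square m ⟩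
      + 1                          ∎
    where open ≡-Reasoning

  sign[m+n]≡sign[m+k]*sign[n+k] : ∀ m n k → sign (m ℕ.+ n) ≡ sign (m ℕ.+ k) * sign (n ℕ.+ k)
  sign[m+n]≡sign[m+k]*sign[n+k] m n k = sym (begin
      sign (m ℕ.+ k) * sign (n ℕ.+ k)          ≡⟨ cong₂ _*_ (sign-+ m k) (sign-+ n k) ⟩
      sign m * sign k * (sign n * sign k)      ≡⟨ regroup (sign m) (sign n) (sign k) ⟩
      sign m * sign n * (sign k * sign k)      ≡⟨ cong (sign m * sign n *_) (sign-square k) ⟩
      sign m * sign n * + 1                    ≡⟨ *-identityʳ _ ⟩
      sign m * sign n                          ≡⟨ sign-+ m n ⟨
      sign (m ℕ.+ n)                           ∎)
    where
    open ≡-Reasoning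
    regroup : ∀ a b c → a * c * (b * c) ≡ a * b * (c * c)
    regroup = solve-∀

  sumTo-cong : ∀ n {f g : ℕ → ℤ} → (∀ i → i ≤ n → f i ≡ g i) → sumTo n f ≡ sumTo n g
  sumTo-cong zero    f≡g = f≡g 0 z≤n
  sumTo-cong (suc n) f≡g =
    cong₂ _+_ (sumTo-cong n (λ i i≤n → f≡g i (ℕ.m≤n⇒m≤1+n i≤n))) (f≡g (suc n) ℕ.≤-refl)

  sumTo-≡0 : ∀ n {f : ℕ → ℤ} → (∀ i → i ≤ n → f i ≡ + 0) → sumTo n f ≡ + 0
  sumTo-≡0 zero    f≡0 = f≡0 0 z≤n
  sumTo-≡0 (suc n) f≡0 =
    cong₂ _+_ (sumTo-≡0 n (λ i i≤n → f≡0 i (ℕ.m≤n⇒m≤1+n i≤n))) (f≡0 (suc n) ℕ.≤-refl)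

  sumTo-distrib-+ : ∀ n (f g : ℕ → ℤ) → sumTo n (λ i → f i + g i) ≡ sumTo n f + sumTo n g
  sumTo-distrib-+ zero    f g = refl
  sumTo-distrib-+ (suc n) f g = trans
    (cong (_+ (f (suc n) + g (suc n))) (sumTo-distrib-+ n f g))
    (interchange (sumTo n f) (sumTo n g) (f (suc n)) (g (suc n)))

  *-distribˡ-sumTo : ∀ n c (f : ℕ → ℤ) → c * sumTo n f ≡ sumTo n (λ i → c * f i)
  *-distribˡ-sumTo zero    c f = refl
  *-distribˡ-sumTo (suc n) c f = trans
    (*-distribˡ-+ c (sumTo n f) (f (suc n)))
    (cong (_+ c * f (suc n)) (*-distribˡ-sumTo n c f))

  sumTo-head : ∀ n (f : ℕ → ℤ) → sumTo (suc n) f ≡ f 0 + sumTo n (f ∘ suc)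
  sumTo-head zero    f = refl
  sumTo-head (suc n) f = trans (cong (_+ f (suc (suc n))) (sumTo-head n f)) (+-assoc (f 0) _ _)

  sumTo-comm : ∀ m n (f : ℕ → ℕ → ℤ) →
    sumTo m (λ i → sumTo n (f i)) ≡ sumTo n (λ j → sumTo m (λ i → f i j))
  sumTo-comm zero    n f = refl
  sumTo-comm (suc m) n f = trans
    (cong (_+ sumTo n (f (suc m))) (sumTo-comm m n f))
    (sym (sumTo-distrib-+ n (λ j → sumTo m (λ i → f i j)) (f (suc m))))

  sumTo-truncate : ∀ {j n} (f : ℕ → ℤ) → j ≤ n → (∀ i → j < i → f i ≡ + 0) →
    sumTo n f ≡ sumTo j f
  sumTo-truncate f j≤n f≡0 with ℕ.m≤n⇒m<n∨m≡n j≤n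
  ... | inj₂ refl          = refl
  ... | inj₁ (s≤s j≤n-1) = trans
    (cong₂ _+_ (sumTo-truncate f j≤n-1 f≡0) (f≡0 _ (s≤s j≤n-1)))
    (+-identityʳ _)

  sumTo-reverse : ∀ n (f : ℕ → ℤ) → sumTo n f ≡ sumTo n (λ j → f (n ∸ j))
  sumTo-reverse zero    f = refl
  sumTo-reverse (suc n) f = begin
      sumTo n f + f (suc n)                   ≡⟨ +-comm (sumTo n f) (f (suc n)) ⟩
      f (suc n) + sumTo n f                   ≡⟨ cong (λ s → f (suc n) + s) (sumTo-reverse n f) ⟩
      f (suc n) + sumTo n (λ j → f (n ∸ j))   ≡⟨ sumTo-head n (λ j → f (suc n ∸ j)) ⟨
      sumTo (suc n) (λ j → f (suc n ∸ j))     ∎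
    where open ≡-Reasoning

  sumTo-δ : ∀ {J n} (x : ℕ → ℤ) → J ≤ n → sumTo n (λ j → + δ J j * x j) ≡ x J
  sumTo-δ {J} x J≤n = trans (sumTo-truncate _ J≤n off-diagonal) (diagonal J)
    where
    off-diagonal : ∀ i → J < i → + δ J i * x i ≡ + 0
    off-diagonal i J<i rewrite m≢n⇒δ≡0 (ℕ.<⇒≢ J<i) = *-zeroˡ (x i)
    diagonal : ∀ J → sumTo J (λ j → + δ J j * x j) ≡ x J
    diagonal zero    = *-identityˡ (x 0)
    diagonal (suc J) rewrite δ-refl J = begin
        sumTo J (λ j → + δ (suc J) j * x j) + + 1 * x (suc J)
      ≡⟨ cong (_+ + 1 * x (suc J)) (sumTo-≡0 J (λ i i≤J →
           cong (λ d → + d * x i) (m≢n⇒δ≡0 (ℕ.>⇒≢ (s≤s i≤J))))) ⟩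
        + 0 + + 1 * x (suc J)
      ≡⟨ +-identityˡ _ ⟩
        + 1 * x (suc J)
      ≡⟨ *-identityˡ (x (suc J)) ⟩
        x (suc J)
      ∎
      where open ≡-Reasoning

  +diagConv≡sumTo : ∀ f g n → + diagConv f g n ≡ sumTo n (λ j → + f j * + g j (n ∸ j))
  +diagConv≡sumTo f g zero    = pos-* (f 0) (g 0 0)
  +diagConv≡sumTo f g (suc n) = begin
      + (f 0 ℕ.* g 0 (suc n) ℕ.+ diagConv (f ∘ suc) (g ∘ suc) n)
    ≡⟨ pos-+ (f 0 ℕ.* g 0 (suc n)) _ ⟩
      + (f 0 ℕ.* g 0 (suc n)) + + diagConv (f ∘ suc) (g ∘ suc) n
    ≡⟨ cong₂ _+_ (pos-* (f 0) (g 0 (suc n))) (+diagConv≡sumTo (f ∘ suc) (g ∘ suc) n) ⟩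
      + f 0 * + g 0 (suc n) + sumTo n (λ j → + f (suc j) * + g (suc j) (n ∸ j))
    ≡⟨ sumTo-head n (λ j → + f j * + g j (suc n ∸ j)) ⟨
      sumTo (suc n) (λ j → + f j * + g j (suc n ∸ j))
    ∎
    where open ≡-Reasoning

  sumTo-binom : ∀ j (f : ℕ → ℤ) →
    sumTo j (λ i → + binom j i * f i) ≡ f 0 + sumTo j (λ i → + binom j (suc i) * f (suc i))
  sumTo-binom j f = begin
      sumTo j g
    ≡⟨ +-identityʳ (sumTo j g) ⟨
      sumTo j g + + 0
    ≡⟨ cong (λ c → sumTo j g + + c * f (suc j)) (n<k⇒binom≡0 (ℕ.n<1+n j)) ⟨
      sumTo (suc j) g
    ≡⟨ sumTo-head j g ⟩
      + 1 * f 0 + sumTo j (g ∘ suc)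
    ≡⟨ cong (_+ sumTo j (g ∘ suc)) (*-identityˡ (f 0)) ⟩
      f 0 + sumTo j (g ∘ suc)
    ∎
    where
    open ≡-Reasoning
    g = λ i → + binom j i * f i

  sumTo-binom-suc : ∀ j (f : ℕ → ℤ) →
    sumTo (suc j) (λ i → + binom (suc j) i * f i) ≡ sumTo j (λ i → + binom j i * (f i + f (suc i)))
  sumTo-binom-suc j f = begin
      sumTo (suc j) (λ i → + binom (suc j) i * f i)
    ≡⟨ sumTo-head j (λ i → + binom (suc j) i * f i) ⟩
      + 1 * f 0 + sumTo j (λ i → + (binom j i ℕ.+ binom j (suc i)) * f (suc i))
    ≡⟨ cong₂ _+_ (*-identityˡ (f 0)) (trans (sumTo-cong j (λ i _ → pascal i)) (sumTo-distrib-+ j _ _)) ⟩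
      f 0 + (Σ[f∘suc] + sumTo j (λ i → + binom j (suc i) * f (suc i)))
    ≡⟨ x∙yz≈y∙xz (f 0) Σ[f∘suc] _ ⟩
      Σ[f∘suc] + (f 0 + sumTo j (λ i → + binom j (suc i) * f (suc i)))
    ≡⟨ cong (λ s → Σ[f∘suc] + s) (sumTo-binom j f) ⟨
      Σ[f∘suc] + Σ[f]
    ≡⟨ +-comm Σ[f∘suc] Σ[f] ⟩
      Σ[f] + Σ[f∘suc]
    ≡⟨ sumTo-distrib-+ j (λ i → + binom j i * f i) (λ i → + binom j i * f (suc i)) ⟨
      sumTo j (λ i → + binom j i * f i + + binom j i * f (suc i))
    ≡⟨ sumTo-cong j (λ i _ → *-distribˡ-+ (+ binom j i) (f i) (f (suc i))) ⟨
      sumTo j (λ i → + binom j i * (f i + f (suc i)))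
    ∎
    where
    open ≡-Reasoning
    Σ[f] = sumTo j (λ i → + binom j i * f i)
    Σ[f∘suc] = sumTo j (λ i → + binom j i * f (suc i))
    pascal : ∀ i → + (binom j i ℕ.+ binom j (suc i)) * f (suc i)
                   ≡ + binom j i * f (suc i) + + binom j (suc i) * f (suc i)
    pascal i = trans (cong (_* f (suc i)) (pos-+ (binom j i) _))
                     (*-distribʳ-+ (f (suc i)) (+ binom j i) (+ binom j (suc i)))

  signedBinom : ℕ → ℕ → ℤ
  signedBinom l i = sign (i ℕ.+ l) * + binom i l

  signedBinom-zero-step : ∀ i → signedBinom 0 i + signedBinom 0 (suc i) ≡ + 0
  signedBinom-zero-step i rewrite sign-suc (i ℕ.+ 0) = cancel (sign (i ℕ.+ 0))
    where
    cancel : ∀ s → s * + 1 + - s * + 1 ≡ + 0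
    cancel = solve-∀

  signedBinom-suc-step : ∀ l i → signedBinom (suc l) i + signedBinom (suc l) (suc i) ≡ signedBinom l i
  signedBinom-suc-step l i
    rewrite sign-suc (i ℕ.+ suc l) | ℕ.+-suc i l | sign-suc (i ℕ.+ l) | pos-+ (binom i l) (binom i (suc l))
    = telescope (sign (i ℕ.+ l)) (+ binom i l) (+ binom i (suc l))
    where
    telescope : ∀ s a b → - s * b + - - s * (a + b) ≡ s * a
    telescope = solve-∀

  binom-orthogonal : ∀ j l → sumTo j (λ i → + binom j i * signedBinom l i) ≡ + δ j l
  binom-orthogonal zero    zero    = refl
  binom-orthogonal zero    (suc l) = trans (*-identityˡ _) (*-zeroʳ (sign (suc l)))
  binom-orthogonal (suc j) zero    = trans (sumTo-binom-suc j (signedBinom 0)) (sumTo-≡0 j λ i _ →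
    trans (cong (+ binom j i *_) (signedBinom-zero-step i)) (*-zeroʳ (+ binom j i)))
  binom-orthogonal (suc j) (suc l) = trans (sumTo-binom-suc j (signedBinom (suc l))) (trans
    (sumTo-cong j (λ i _ → cong (+ binom j i *_) (signedBinom-suc-step l i)))
    (binom-orthogonal j l))

  binomial-inversion : ∀ {J n} (f g : ℕ → ℤ) → J ≤ n →
    (∀ i → g i ≡ sumTo n (λ j → + binom i j * f j)) →
    sumTo J (λ i → sign (J ℕ.+ i) * (+ binom J i * g i)) ≡ f J
  binomial-inversion {J} {n} f g J≤n g≡ = begin
      sumTo J (λ i → sign (J ℕ.+ i) * (+ binom J i * g i))
    ≡⟨ sumTo-cong J (λ i _ → expand i) ⟩
      sumTo J (λ i → sumTo n (λ j → sign (J ℕ.+ i) * (+ binom J i * (+ binom i j * f j))))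
    ≡⟨ sumTo-comm J n _ ⟩
      sumTo n (λ j → sumTo J (λ i → sign (J ℕ.+ i) * (+ binom J i * (+ binom i j * f j))))
    ≡⟨ sumTo-cong n (λ j _ → trans (sumTo-cong J (λ i _ → regroup i j))
                                        (sym (*-distribˡ-sumTo J (sign (J ℕ.+ j) * f j) _))) ⟩
      sumTo n (λ j → sign (J ℕ.+ j) * f j * sumTo J (λ i → + binom J i * signedBinom j i))
    ≡⟨ sumTo-cong n (λ j _ → trans (cong (sign (J ℕ.+ j) * f j *_) (binom-orthogonal J j))
                                        (*-comm (sign (J ℕ.+ j) * f j) (+ δ J j))) ⟩
      sumTo n (λ j → + δ J j * (sign (J ℕ.+ j) * f j))
    ≡⟨ sumTo-δ (λ j → sign (J ℕ.+ j) * f j) J≤n ⟩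
      sign (J ℕ.+ J) * f J
    ≡⟨ cong (_* f J) (trans (sign-+ J J) (sign-square J)) ⟩
      + 1 * f J
    ≡⟨ *-identityˡ (f J) ⟩
      f J
    ∎
    where
    open ≡-Reasoning
    expand : ∀ i → sign (J ℕ.+ i) * (+ binom J i * g i)
                   ≡ sumTo n (λ j → sign (J ℕ.+ i) * (+ binom J i * (+ binom i j * f j)))
    expand i = begin
        sign (J ℕ.+ i) * (+ binom J i * g i)
      ≡⟨ cong (λ x → sign (J ℕ.+ i) * (+ binom J i * x)) (g≡ i) ⟩
        sign (J ℕ.+ i) * (+ binom J i * sumTo n (λ j → + binom i j * f j))
      ≡⟨ cong (sign (J ℕ.+ i) *_) (*-distribˡ-sumTo n (+ binom J i) _) ⟩
        sign (J ℕ.+ i) * sumTo n (λ j → + binom J i * (+ binom i j * f j))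
      ≡⟨ *-distribˡ-sumTo n (sign (J ℕ.+ i)) _ ⟩
        sumTo n (λ j → sign (J ℕ.+ i) * (+ binom J i * (+ binom i j * f j)))
      ∎
    regroup : ∀ i j → sign (J ℕ.+ i) * (+ binom J i * (+ binom i j * f j))
                      ≡ sign (J ℕ.+ j) * f j * (+ binom J i * signedBinom j i)
    regroup i j rewrite sign[m+n]≡sign[m+k]*sign[n+k] J i j =
      rearrange (sign (J ℕ.+ j)) (sign (i ℕ.+ j)) (+ binom J i) (+ binom i j) (f j)
      where
      rearrange : ∀ s t a b x → s * t * (a * (b * x)) ≡ s * x * (a * (t * b))
      rearrange = solve-∀

  δ≡sumTo-signedBinom : ∀ {d n} p → d ≤ n → + δ d p ≡ sumTo n (λ q → signedBinom p q * + binom d q)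
  δ≡sumTo-signedBinom {d} {n} p d≤n = sym (begin
      sumTo n (λ q → signedBinom p q * + binom d q)
    ≡⟨ sumTo-truncate _ d≤n (λ q d<q → trans
         (cong (λ c → signedBinom p q * + c) (n<k⇒binom≡0 d<q)) (*-zeroʳ (signedBinom p q))) ⟩
      sumTo d (λ q → signedBinom p q * + binom d q)
    ≡⟨ sumTo-cong d (λ q _ → *-comm (signedBinom p q) (+ binom d q)) ⟩
      sumTo d (λ q → + binom d q * signedBinom p q)
    ≡⟨ binom-orthogonal d p ⟩
      + δ d p
    ∎)
    where open ≡-Reasoning

module NatSums where

  open import Data.Bool.Base using (Bool; true; false)
  open import Data.Fin.Base as Fin using (Fin; toℕ)
  open import Data.List.Base using (List; []; _∷_; _++_; map; concatMap; tabulate; length; filterᵇ)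
  open import Data.Nat.Base
  open import Data.Nat.Properties
  open import Data.Sum.Base using (inj₁; inj₂)
  open import Function.Base using (_∘_)
  open import Relation.Binary.PropositionalEquality
  open import Algebra.Properties.CommutativeSemigroup +-commutativeSemigroup using (interchange)
  open import Algebra.Properties.CommutativeMonoid.Sum +-0-commutativeMonoid public
    using (sum; sum-syntax; sum-cong-≗; ∑-distrib-+; sum-replicate-zero; sum-init-last)
  open Binomial using (iverson)
  open Convolution using (_⋆_; ⋆-zeroˡ; ⋆-distribʳ-+)

  sumList : {A : Set} → (A → ℕ) → List A → ℕ
  sumList f []       = 0
  sumList f (x ∷ xs) = f x + sumList f xs

  sumList-cong : ∀ {A : Set} {f g : A → ℕ} xs → (∀ x → f x ≡ g x) → sumList f xs ≡ sumList g xs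
  sumList-cong []       f≡g = refl
  sumList-cong (x ∷ xs) f≡g = cong₂ _+_ (f≡g x) (sumList-cong xs f≡g)

  sumList-≡0 : ∀ {A : Set} {f : A → ℕ} xs → (∀ x → f x ≡ 0) → sumList f xs ≡ 0
  sumList-≡0 []       f≡0 = refl
  sumList-≡0 (x ∷ xs) f≡0 = cong₂ _+_ (f≡0 x) (sumList-≡0 xs f≡0)

  sumList-distrib-+ : ∀ {A : Set} (f g : A → ℕ) xs →
    sumList (λ x → f x + g x) xs ≡ sumList f xs + sumList g xs
  sumList-distrib-+ f g []       = refl
  sumList-distrib-+ f g (x ∷ xs) = trans
    (cong (f x + g x +_) (sumList-distrib-+ f g xs))
    (interchange (f x) (g x) (sumList f xs) (sumList g xs))

  sumList-++ : ∀ {A : Set} (f : A → ℕ) xs ys → sumList f (xs ++ ys) ≡ sumList f xs + sumList f ys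
  sumList-++ f []       ys = refl
  sumList-++ f (x ∷ xs) ys = trans (cong (f x +_) (sumList-++ f xs ys)) (sym (+-assoc (f x) _ _))

  sumList-map : ∀ {A B : Set} (f : A → ℕ) (h : B → A) xs → sumList f (map h xs) ≡ sumList (f ∘ h) xs
  sumList-map f h []       = refl
  sumList-map f h (x ∷ xs) = cong (f (h x) +_) (sumList-map f h xs)

  sumList-concatMap : ∀ {A B : Set} (f : A → ℕ) (g : B → List A) xs →
    sumList f (concatMap g xs) ≡ sumList (sumList f ∘ g) xs
  sumList-concatMap f g []       = refl
  sumList-concatMap f g (x ∷ xs) =
    trans (sumList-++ f (g x) (concatMap g xs)) (cong (sumList f (g x) +_) (sumList-concatMap f g xs))

  sumList-tabulate : ∀ {A : Set} {n} (f : A → ℕ) (h : Fin n → A) →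
    sumList f (tabulate h) ≡ ∑[ i < n ] f (h i)
  sumList-tabulate {n = zero}  f h = refl
  sumList-tabulate {n = suc n} f h = cong (f (h Fin.zero) +_) (sumList-tabulate f (h ∘ Fin.suc))

  length-filterᵇ : ∀ {A : Set} (P : A → Bool) xs → length (filterᵇ P xs) ≡ sumList (iverson ∘ P) xs
  length-filterᵇ P []       = refl
  length-filterᵇ P (x ∷ xs) with P x
  ... | true  = cong suc (length-filterᵇ P xs)
  ... | false = length-filterᵇ P xs

  sumBelow : ℕ → (ℕ → ℕ) → ℕ
  sumBelow zero    g = 0
  sumBelow (suc n) g = g 0 + sumBelow n (g ∘ suc)

  ∑-toℕ : ∀ n g → ∑[ i < n ] g (toℕ i) ≡ sumBelow n g
  ∑-toℕ zero    g = refl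
  ∑-toℕ (suc n) g = cong (g 0 +_) (∑-toℕ n (g ∘ suc))

  sumBelow-cong : ∀ n {g h : ℕ → ℕ} → (∀ t → t < n → g t ≡ h t) → sumBelow n g ≡ sumBelow n h
  sumBelow-cong zero    g≡h = refl
  sumBelow-cong (suc n) g≡h = cong₂ _+_ (g≡h 0 z<s) (sumBelow-cong n (λ t t<n → g≡h (suc t) (s<s t<n)))

  sumBelow-≡0 : ∀ n {g : ℕ → ℕ} → (∀ t → t < n → g t ≡ 0) → sumBelow n g ≡ 0
  sumBelow-≡0 n g≡0 = trans (sumBelow-cong n g≡0) (sumBelow-zero n)
    where
    sumBelow-zero : ∀ n → sumBelow n (λ _ → 0) ≡ 0
    sumBelow-zero zero    = refl
    sumBelow-zero (suc n) = sumBelow-zero n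

  sumBelow-suc : ∀ n g → sumBelow (suc n) g ≡ sumBelow n g + g n
  sumBelow-suc zero    g = +-comm (g 0) 0
  sumBelow-suc (suc n) g =
    trans (cong (g 0 +_) (sumBelow-suc n (g ∘ suc))) (sym (+-assoc (g 0) _ (g (suc n))))

  <ᵇ-true : ∀ {m n} → m < n → (m <ᵇ n) ≡ true
  <ᵇ-true {zero}  (s≤s _)   = refl
  <ᵇ-true {suc m} (s≤s m<n) = <ᵇ-true m<n

  <ᵇ-false : ∀ {m n} → n ≤ m → (m <ᵇ n) ≡ false
  <ᵇ-false z≤n       = refl
  <ᵇ-false (s≤s n≤m) = <ᵇ-false n≤m

  sumBelow-<ᵇ : ∀ {s N} g → s ≤ N → sumBelow N (λ t → iverson (t <ᵇ s) * g t) ≡ sumBelow s g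
  sumBelow-<ᵇ {s} g s≤N with m≤n⇒m<n∨m≡n s≤N
  ... | inj₂ refl = sumBelow-cong s λ t t<s →
    trans (cong (λ b → iverson b * g t) (<ᵇ-true t<s)) (*-identityˡ (g t))
  ... | inj₁ (s≤s {n = N-1} s≤N-1) = begin
      sumBelow (suc N-1) (λ t → iverson (t <ᵇ s) * g t)
    ≡⟨ sumBelow-suc N-1 (λ t → iverson (t <ᵇ s) * g t) ⟩
      sumBelow N-1 (λ t → iverson (t <ᵇ s) * g t) + iverson (N-1 <ᵇ s) * g N-1
    ≡⟨ cong₂ _+_ (sumBelow-<ᵇ g s≤N-1) (cong (λ b → iverson b * g N-1) (<ᵇ-false s≤N-1)) ⟩
      sumBelow s g + 0
    ≡⟨ +-identityʳ _ ⟩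
      sumBelow s g
    ∎
    where open ≡-Reasoning

  ⋆-sumBelow : ∀ t (f : ℕ → ℕ → ℕ) g n →
    ((λ r → sumBelow t (λ b → f b r)) ⋆ g) n ≡ sumBelow t (λ b → (f b ⋆ g) n)
  ⋆-sumBelow zero    f g n = ⋆-zeroˡ g (λ _ → refl) n
  ⋆-sumBelow (suc t) f g n = trans
    (⋆-distribʳ-+ (f 0) (λ r → sumBelow t (λ b → f (suc b) r)) g n)
    (cong ((f 0 ⋆ g) n +_) (⋆-sumBelow t (f ∘ suc) g n))

module Words where

  open import Data.Bool.Base using (true; false; _∧_)
  open import Data.Fin.Base using (Fin)
  open import Data.List.Base using (map; tabulate)
  open import Data.Nat.Base
  open import Data.Nat.Properties using (m≤n⇒m≤1+n)
  open import Data.Vec.Base using (Vec; []; _∷_)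
  open import Function.Base using (_∘_; id)
  open import Relation.Binary.PropositionalEquality
  open import Defs using (words; desX; val)
  open NatSums

  sumList-words-suc : ∀ N n (f : Vec (Fin N) (suc n) → ℕ) →
    sumList f (words N (suc n)) ≡ ∑[ a < N ] sumList (f ∘ (a ∷_)) (words N n)
  sumList-words-suc N n f = begin
      sumList f (words N (suc n))
    ≡⟨ sumList-concatMap f (λ a → map (a ∷_) (words N n)) (tabulate id) ⟩
      sumList (λ a → sumList f (map (a ∷_) (words N n))) (tabulate id)
    ≡⟨ sumList-tabulate {n = N} (λ a → sumList f (map (a ∷_) (words N n))) id ⟩
      ∑[ a < N ] sumList f (map (a ∷_) (words N n))
    ≡⟨ sum-cong-≗ {N} (λ a → sumList-map f (a ∷_) (words N n)) ⟩
      ∑[ a < N ] sumList (f ∘ (a ∷_)) (words N n)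
    ∎
    where open ≡-Reasoning

  desX-∷-≤ : ∀ X {N n} (a : Fin N) (w : Vec (Fin N) n) → desX X (a ∷ w) ≤ n
  desX-∷-≤ X a []      = z≤n
  desX-∷-≤ X a (b ∷ w) with (val b <ᵇ val a) ∧ X (val a)
  ... | true  = s≤s (desX-∷-≤ X b w)
  ... | false = m≤n⇒m≤1+n (desX-∷-≤ X b w)

  desX-≤ : ∀ X {N n} (w : Vec (Fin N) n) → desX X w ≤ n
  desX-≤ X []      = z≤n
  desX-≤ X (a ∷ w) = m≤n⇒m≤1+n (desX-∷-≤ X a w)

module Runs where

  open import Data.Bool.Base using (true; false; not; _∧_; if_then_else_)
  open import Data.Bool.Properties using (not-involutive; ∧-identityʳ; ∧-zeroʳ)
  open import Data.Fin.Base using (Fin; toℕ)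
  open import Data.Fin.Properties using (toℕ<n)
  open import Data.Nat.Base
  open import Data.Nat.Properties
  open import Function.Base using (_∘_)
  open import Relation.Binary.PropositionalEquality
  open import Defs using (even; isO; val)
  open Binomial
  open Convolution
  open NatSums

  even-suc : ∀ m → even (suc m) ≡ not (even m)
  even-suc zero    = refl
  even-suc (suc m) = trans (sym (not-involutive (even m))) (cong not (sym (even-suc m)))

  even-2* : ∀ k → even (2 * k) ≡ true
  even-2* zero    = refl
  even-2* (suc k) = trans (cong even (*-suc 2 k)) (even-2* k)

  ⌊2*n/2⌋≡n : ∀ n → ⌊ 2 * n /2⌋ ≡ n
  ⌊2*n/2⌋≡n n = trans (cong (λ m → ⌊ n + m /2⌋) (+-identityʳ n)) (sym (n≡⌊n+n/2⌋ n))

  -- runsFrom t r counts the sequences t + 1 = a₀ > a₁ > ⋯ > aᵣ ≥ 1 with a₀, …, aᵣ₋₁ odd: the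
  -- possible runs of r consecutive marked descents starting at a letter of value t + 1.
  runsFrom : ℕ → ℕ → ℕ
  runsFrom t zero    = 1
  runsFrom t (suc r) = if even t then 2 * binom ⌊ t /2⌋ (suc r) else 0

  runsFrom-even : ∀ t → even t ≡ true → ∀ r → runsFrom t (suc r) ≡ 2 * binom ⌊ t /2⌋ (suc r)
  runsFrom-even t even-t r rewrite even-t = refl

  runsFrom-odd : ∀ t → even t ≡ false → ∀ r → runsFrom t (suc r) ≡ 0
  runsFrom-odd t odd-t r rewrite odd-t = refl

  runsFrom-pair : ∀ t → even t ≡ true → ∀ r → runsFrom t r + runsFrom (suc t) r ≡ 2 * binom ⌊ t /2⌋ r
  runsFrom-pair t even-t zero    = refl
  runsFrom-pair t even-t (suc r) = trans
    (cong₂ _+_ (runsFrom-even t even-t r) (runsFrom-odd (suc t) (trans (even-suc t) (cong not even-t)) r))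
    (+-identityʳ _)

  sumBelow-runsFrom : ∀ t → even t ≡ true → ∀ r →
    sumBelow t (λ b → runsFrom b r) ≡ 2 * binom ⌊ t /2⌋ (suc r)
  sumBelow-runsFrom zero          _      r = refl
  sumBelow-runsFrom (suc (suc t)) even-t r = begin
      sumBelow (2 + t) R
    ≡⟨ sumBelow-suc (suc t) R ⟩
      sumBelow (suc t) R + R (suc t)
    ≡⟨ cong (_+ R (suc t)) (sumBelow-suc t R) ⟩
      sumBelow t R + R t + R (suc t)
    ≡⟨ +-assoc (sumBelow t R) (R t) (R (suc t)) ⟩
      sumBelow t R + (R t + R (suc t))
    ≡⟨ cong₂ _+_ (sumBelow-runsFrom t even-t r) (runsFrom-pair t even-t r) ⟩
      2 * binom ⌊ t /2⌋ (suc r) + 2 * binom ⌊ t /2⌋ r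
    ≡⟨ +-comm (2 * binom ⌊ t /2⌋ (suc r)) _ ⟩
      2 * binom ⌊ t /2⌋ r + 2 * binom ⌊ t /2⌋ (suc r)
    ≡⟨ *-distribˡ-+ 2 (binom ⌊ t /2⌋ r) (binom ⌊ t /2⌋ (suc r)) ⟨
      2 * binom ⌊ 2 + t /2⌋ (suc r)
    ∎
    where
    open ≡-Reasoning
    R = λ b → runsFrom b r

  -- A marked descent a > b followed by a run starting at b is a run starting at a.
  ∑-descents-⋆ : ∀ {N} (a : Fin N) g q →
    ∑[ b < N ] (iverson ((val b <ᵇ val a) ∧ isO (val a)) * (runsFrom (toℕ b) ⋆ g) q)
      ≡ (runsFrom (toℕ a) ∘ suc ⋆ g) q
  ∑-descents-⋆ {N} a g q with even (toℕ a) in even-a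
  ... | true  = begin
      ∑[ b < N ] (iverson ((toℕ b <ᵇ toℕ a) ∧ true) * G (toℕ b))
    ≡⟨ ∑-toℕ N (λ t → iverson ((t <ᵇ toℕ a) ∧ true) * G t) ⟩
      sumBelow N (λ t → iverson ((t <ᵇ toℕ a) ∧ true) * G t)
    ≡⟨ sumBelow-cong N (λ t _ → cong (λ e → iverson e * G t) (∧-identityʳ (t <ᵇ toℕ a))) ⟩
      sumBelow N (λ t → iverson (t <ᵇ toℕ a) * G t)
    ≡⟨ sumBelow-<ᵇ G (<⇒≤ (toℕ<n a)) ⟩
      sumBelow (toℕ a) G
    ≡⟨ ⋆-sumBelow (toℕ a) runsFrom g q ⟨
      ((λ r → sumBelow (toℕ a) (λ t → runsFrom t r)) ⋆ g) q
    ≡⟨ ⋆-cong (sumBelow-runsFrom (toℕ a) even-a) (λ _ → refl) q ⟩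
      ((λ r → 2 * binom ⌊ toℕ a /2⌋ (suc r)) ⋆ g) q
    ∎
    where
    open ≡-Reasoning
    G = λ t → (runsFrom t ⋆ g) q
  ... | false = begin
      ∑[ b < N ] (iverson ((toℕ b <ᵇ toℕ a) ∧ false) * G (toℕ b))
    ≡⟨ ∑-toℕ N (λ t → iverson ((t <ᵇ toℕ a) ∧ false) * G t) ⟩
      sumBelow N (λ t → iverson ((t <ᵇ toℕ a) ∧ false) * G t)
    ≡⟨ sumBelow-≡0 N (λ t _ → cong (λ e → iverson e * G t) (∧-zeroʳ (t <ᵇ toℕ a))) ⟩
      0
    ≡⟨ ⋆-zeroˡ g (λ _ → refl) q ⟨
      ((λ _ → 0) ⋆ g) q
    ∎
    where
    open ≡-Reasoning
    G = λ t → (runsFrom t ⋆ g) q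

module MarkedDescents (k : ℕ) where

  open import Data.Bool.Base using (true; false; _∧_)
  open import Data.Fin.Base using (Fin; toℕ)
  open import Data.Nat.Base
  open import Data.Nat.Properties
  open import Data.Vec.Base using (_∷_)
  open import Function.Base using (_∘_)
  open import Relation.Binary.PropositionalEquality
  open import Defs using (words; desX; isO; val)
  open Binomial
  open Convolution
  open NatSums
  open Words
  open Runs

  N : ℕ
  N = 2 * k

  -- moment n q counts the pairs (w, S) with w ∈ [N]ⁿ and S a q-set of descents of w at odd letters;
  -- momentFrom n a q does the same for the words a w with w ∈ [N]ⁿ.
  moment : ℕ → ℕ → ℕ
  moment n q = sumList (λ w → binom (desX isO w) q) (words N n)

  momentFrom : ℕ → Fin N → ℕ → ℕ
  momentFrom n a q = sumList (λ w → binom (desX isO (a ∷ w)) q) (words N n)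

  -- runSeqs j q counts the sequences of j runs with q marked descents in total.
  runSeqs : ℕ → ℕ → ℕ
  runSeqs = convPow (λ r → 2 * binom k (suc r))

  sumBelow-N-runsFrom : ∀ r → sumBelow N (λ t → runsFrom t r) ≡ 2 * binom k (suc r)
  sumBelow-N-runsFrom r =
    trans (sumBelow-runsFrom N (even-2* k) r) (cong (λ m → 2 * binom m (suc r)) (⌊2*n/2⌋≡n k))

  moment-suc : ∀ n q → moment (suc n) q ≡ ∑[ a < N ] momentFrom n a q
  moment-suc n q = sumList-words-suc N n (λ w → binom (desX isO w) q)

  momentFrom-suc-zero : ∀ n a → momentFrom (suc n) a 0 ≡ ∑[ b < N ] momentFrom n b 0
  momentFrom-suc-zero n a = sumList-words-suc N n (λ _ → 1)

  momentFrom-suc-suc : ∀ n a q →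
    momentFrom (suc n) a (suc q)
      ≡ ∑[ b < N ] momentFrom n b (suc q)
        + ∑[ b < N ] (iverson ((val b <ᵇ val a) ∧ isO (val a)) * momentFrom n b q)
  momentFrom-suc-suc n a q = trans
    (sumList-words-suc N n (λ w → binom (desX isO (a ∷ w)) (suc q)))
    (trans (sum-cong-≗ {N} first-step) (∑-distrib-+ (λ b → momentFrom n b (suc q)) _))
    where
    first-step : ∀ b → sumList (λ w → binom (desX isO (a ∷ b ∷ w)) (suc q)) (words N n)
                       ≡ momentFrom n b (suc q) + iverson ((val b <ᵇ val a) ∧ isO (val a)) * momentFrom n b q
    first-step b with (val b <ᵇ val a) ∧ isO (val a)
    ... | true  = begin
        sumList (λ w → binom (desX isO (b ∷ w)) q + binom (desX isO (b ∷ w)) (suc q)) (words N n)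
      ≡⟨ sumList-distrib-+ (λ w → binom (desX isO (b ∷ w)) q) _ (words N n) ⟩
        momentFrom n b q + momentFrom n b (suc q)
      ≡⟨ +-comm (momentFrom n b q) _ ⟩
        momentFrom n b (suc q) + momentFrom n b q
      ≡⟨ cong (momentFrom n b (suc q) +_) (*-identityˡ _) ⟨
        momentFrom n b (suc q) + 1 * momentFrom n b q
      ∎
      where open ≡-Reasoning
    ... | false = sym (+-identityʳ _)

  momentFrom-≡0 : ∀ n a q → n < q → momentFrom n a q ≡ 0
  momentFrom-≡0 n a q n<q =
    sumList-≡0 (words N n) (λ w → n<k⇒binom≡0 (≤-<-trans (desX-∷-≤ isO a w) n<q))

  MomentsFactor : ℕ → Set
  MomentsFactor n = ∀ j q → j + q ≡ n → ∀ a → momentFrom n a q ≡ (runsFrom (toℕ a) ⋆ runSeqs j) q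

  ∑momentFrom≡runSeqs : ∀ {n} → MomentsFactor n → ∀ j q → j + q ≡ suc n →
    ∑[ b < N ] momentFrom n b q ≡ runSeqs j q
  ∑momentFrom≡runSeqs {n} factor zero .(suc n) refl = begin
      ∑[ b < N ] momentFrom n b (suc n)
    ≡⟨ sum-cong-≗ {N} (λ b → momentFrom-≡0 n b (suc n) ≤-refl) ⟩
      ∑[ b < N ] 0
    ≡⟨ sum-replicate-zero N ⟩
      0
    ∎
    where open ≡-Reasoning
  ∑momentFrom≡runSeqs {n} factor (suc j) q j+q≡n = begin
      ∑[ b < N ] momentFrom n b q
    ≡⟨ sum-cong-≗ {N} (factor j q (suc-injective j+q≡n)) ⟩
      ∑[ b < N ] (runsFrom (toℕ b) ⋆ runSeqs j) q
    ≡⟨ ∑-toℕ N (λ t → (runsFrom t ⋆ runSeqs j) q) ⟩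
      sumBelow N (λ t → (runsFrom t ⋆ runSeqs j) q)
    ≡⟨ ⋆-sumBelow N runsFrom (runSeqs j) q ⟨
      ((λ r → sumBelow N (λ t → runsFrom t r)) ⋆ runSeqs j) q
    ≡⟨ ⋆-cong sumBelow-N-runsFrom (λ _ → refl) q ⟩
      runSeqs (suc j) q
    ∎
    where open ≡-Reasoning

  momentFrom≡runsFrom⋆runSeqs : ∀ n → MomentsFactor n
  momentFrom≡runsFrom⋆runSeqs zero    zero zero    _         a = refl
  momentFrom≡runsFrom⋆runSeqs (suc n) j    zero    j+0≡1+n   a = begin
      momentFrom (suc n) a 0
    ≡⟨ momentFrom-suc-zero n a ⟩
      ∑[ b < N ] momentFrom n b 0
    ≡⟨ ∑momentFrom≡runSeqs (momentFrom≡runsFrom⋆runSeqs n) j 0 j+0≡1+n ⟩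
      runSeqs j 0
    ≡⟨ *-identityˡ _ ⟨
      (runsFrom (toℕ a) ⋆ runSeqs j) 0
    ∎
    where open ≡-Reasoning
  momentFrom≡runsFrom⋆runSeqs (suc n) j    (suc q) j+1+q≡1+n a = begin
      momentFrom (suc n) a (suc q)
    ≡⟨ momentFrom-suc-suc n a q ⟩
      ∑[ b < N ] momentFrom n b (suc q) + ∑[ b < N ] (descent b * momentFrom n b q)
    ≡⟨ cong₂ _+_ (∑momentFrom≡runSeqs factor j (suc q) j+1+q≡1+n)
                 (sum-cong-≗ {N} (λ b → cong (descent b *_) (factor j q j+q≡n b))) ⟩
      runSeqs j (suc q) + ∑[ b < N ] (descent b * (runsFrom (toℕ b) ⋆ runSeqs j) q)
    ≡⟨ cong (runSeqs j (suc q) +_) (∑-descents-⋆ a (runSeqs j) q) ⟩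
      runSeqs j (suc q) + (runsFrom (toℕ a) ∘ suc ⋆ runSeqs j) q
    ≡⟨ cong (_+ (runsFrom (toℕ a) ∘ suc ⋆ runSeqs j) q) (*-identityˡ _) ⟨
      (runsFrom (toℕ a) ⋆ runSeqs j) (suc q)
    ∎
    where
    open ≡-Reasoning
    factor = momentFrom≡runsFrom⋆runSeqs n
    descent = λ (b : Fin N) → iverson ((val b <ᵇ val a) ∧ isO (val a))
    j+q≡n = suc-injective (trans (sym (+-suc j q)) j+1+q≡1+n)

  moment≡runSeqs : ∀ {n} j q → j + q ≡ n → moment n q ≡ runSeqs j q
  moment≡runSeqs {zero}  zero zero _         = refl
  moment≡runSeqs {suc n} j    q    j+q≡1+n =
    trans (moment-suc n q) (∑momentFrom≡runSeqs (momentFrom≡runsFrom⋆runSeqs n) j q j+q≡1+n)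

module Complement where

  open import Data.Bool.Base using (true; false; not; _xor_; T)
  open import Data.Bool.Properties using (not-distribˡ-xor)
  open import Data.Fin.Base using (Fin; toℕ; opposite; inject₁; fromℕ)
  open import Data.Fin.Properties using (toℕ<n; opposite-prop)
  open import Data.List.Base using (filterᵇ; length)
  open import Data.Nat.Base
  open import Data.Nat.Properties
  open import Data.Vec.Base as Vec using (Vec; []; _∷_)
  open import Function.Base using (_∘_)
  open import Relation.Binary.PropositionalEquality
  open import Relation.Nullary.Reflects using (det; fromEquivalence)
  open import Defs using (even; isO; isE; val; words; desX; risX; countWords)
  open Binomial using (iverson)
  open NatSums
  open Words
  open Runs using (even-suc)

  ∑-opposite : ∀ n (h : Fin n → ℕ) → ∑[ i < n ] h (opposite i) ≡ sum h
  ∑-opposite zero    h = refl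
  ∑-opposite (suc n) h = begin
      h (fromℕ n) + ∑[ i < n ] h (inject₁ (opposite i))
    ≡⟨ cong (h (fromℕ n) +_) (∑-opposite n (h ∘ inject₁)) ⟩
      h (fromℕ n) + ∑[ i < n ] h (inject₁ i)
    ≡⟨ +-comm (h (fromℕ n)) _ ⟩
      ∑[ i < n ] h (inject₁ i) + h (fromℕ n)
    ≡⟨ sum-init-last h ⟨
      sum h
    ∎
    where open ≡-Reasoning

  sumList-words-opposite : ∀ N n (f : Vec (Fin N) n → ℕ) →
    sumList f (words N n) ≡ sumList (f ∘ Vec.map opposite) (words N n)
  sumList-words-opposite N zero    f = refl
  sumList-words-opposite N (suc n) f = begin
      sumList f (words N (suc n))
    ≡⟨ sumList-words-suc N n f ⟩
      ∑[ a < N ] sumList (f ∘ (a ∷_)) (words N n)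
    ≡⟨ ∑-opposite N (λ a → sumList (f ∘ (a ∷_)) (words N n)) ⟨
      ∑[ a < N ] sumList (f ∘ (opposite a ∷_)) (words N n)
    ≡⟨ sum-cong-≗ {N} (λ a → sumList-words-opposite N n (f ∘ (opposite a ∷_))) ⟩
      ∑[ a < N ] sumList (f ∘ (opposite a ∷_) ∘ Vec.map opposite) (words N n)
    ≡⟨ sumList-words-suc N n (f ∘ Vec.map opposite) ⟨
      sumList (f ∘ Vec.map opposite) (words N (suc n))
    ∎
    where open ≡-Reasoning

  val-opposite : ∀ {N} (a : Fin N) → val (opposite a) ≡ N ∸ toℕ a
  val-opposite a = trans (cong suc (opposite-prop a)) (sym (+-∸-assoc 1 (toℕ<n a)))

  <ᵇ-opposite : ∀ {N} (a b : Fin N) → (val (opposite a) <ᵇ val (opposite b)) ≡ (val b <ᵇ val a)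
  <ᵇ-opposite {N} a b = trans
    (cong₂ _<ᵇ_ (val-opposite a) (val-opposite b))
    (det (<ᵇ-reflects-< (N ∸ toℕ a) (N ∸ toℕ b)) (fromEquivalence to from))
    where
    to : T (toℕ b <ᵇ toℕ a) → N ∸ toℕ a < N ∸ toℕ b
    to b<a = ∸-monoʳ-< (<ᵇ⇒< (toℕ b) (toℕ a) b<a) (<⇒≤ (toℕ<n a))
    from : N ∸ toℕ a < N ∸ toℕ b → T (toℕ b <ᵇ toℕ a)
    from N-a<N-b = <⇒<ᵇ {toℕ b} {toℕ a} (≰⇒> λ a≤b → <⇒≱ N-a<N-b (∸-monoʳ-≤ N a≤b))

  even-+ : ∀ m n → even (m + n) ≡ not (even m) xor even n
  even-+ zero    n = refl
  even-+ (suc m) n = begin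
      even (suc (m + n))             ≡⟨ even-suc (m + n) ⟩
      not (even (m + n))             ≡⟨ cong not (even-+ m n) ⟩
      not (not (even m) xor even n)  ≡⟨ not-distribˡ-xor (not (even m)) (even n) ⟩
      not (not (even m)) xor even n  ≡⟨ cong (λ e → not e xor even n) (even-suc m) ⟨
      not (even (suc m)) xor even n  ∎
    where open ≡-Reasoning

  even-∸ : ∀ {m n} → even m ≡ true → n ≤ m → even (m ∸ n) ≡ even n
  even-∸ {m} {n} even-m n≤m = agree (even (m ∸ n)) (even n) (begin
      not (even (m ∸ n)) xor even n  ≡⟨ even-+ (m ∸ n) n ⟨
      even (m ∸ n + n)               ≡⟨ cong even (m∸n+n≡m n≤m) ⟩
      even m                         ≡⟨ even-m ⟩
      true                           ∎)
    where
    open ≡-Reasoning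
    agree : ∀ x y → not x xor y ≡ true → x ≡ y
    agree true  true  _ = refl
    agree false false _ = refl

  even-val-opposite : ∀ {N} → even N ≡ true → (a : Fin N) → even (val (opposite a)) ≡ isO (val a)
  even-val-opposite even-N a = trans (cong even (val-opposite a)) (even-∸ even-N (<⇒≤ (toℕ<n a)))

  risX-opposite : ∀ {N n} → even N ≡ true → (w : Vec (Fin N) n) → risX isE (Vec.map opposite w) ≡ desX isO w
  risX-opposite even-N []          = refl
  risX-opposite even-N (a ∷ [])    = refl
  risX-opposite even-N (a ∷ b ∷ w)
    rewrite risX-opposite even-N (b ∷ w) | <ᵇ-opposite a b | even-val-opposite even-N a = refl

  countWords-risX≡desX : ∀ {N} → even N ≡ true → ∀ n p →
    countWords N n (risX isE) p ≡ countWords N n (desX isO) p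
  countWords-risX≡desX {N} even-N n p = begin
      length (filterᵇ (λ w → risX isE w ≡ᵇ p) (words N n))
    ≡⟨ length-filterᵇ (λ w → risX isE w ≡ᵇ p) (words N n) ⟩
      sumList (λ w → iverson (risX isE w ≡ᵇ p)) (words N n)
    ≡⟨ sumList-words-opposite N n (λ w → iverson (risX isE w ≡ᵇ p)) ⟩
      sumList (λ w → iverson (risX isE (Vec.map opposite w) ≡ᵇ p)) (words N n)
    ≡⟨ sumList-cong (words N n) (λ w → cong (λ d → iverson (d ≡ᵇ p)) (risX-opposite even-N w)) ⟩
      sumList (λ w → iverson (desX isO w ≡ᵇ p)) (words N n)
    ≡⟨ length-filterᵇ (λ w → desX isO w ≡ᵇ p) (words N n) ⟨
      length (filterᵇ (λ w → desX isO w ≡ᵇ p) (words N n))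
    ∎
    where open ≡-Reasoning

module DescentFormula (k : ℕ) where

  open import Data.Nat.Base as ℕ using (suc; _≤_; _∸_; _^_)
  import Data.Nat.Properties as ℕ
  open import Data.Nat.Combinatorics using (_C_)
  open import Data.Integer.Base using (ℤ; +_; _+_; _*_)
  open import Data.Integer.Properties
  open import Data.Integer.Tactic.RingSolver using (solve-∀)
  import Data.Nat.Tactic.RingSolver as ℕ
  open import Data.List.Base using ([]; _∷_)
  open import Function.Base using (_∘_)
  open import Relation.Binary.PropositionalEquality
  open import Defs using (sign; sumTo; formula; countWords; words; desX; isO)
  open Binomial
  open Convolution using (convPow; convPow-*; binom[k*i]≡diagConv)
  open AlternatingSums
  open NatSums using (sumList; length-filterᵇ)
  open Words using (desX-≤)
  open MarkedDescents k

  +sumList≡sumTo : ∀ {A : Set} n (c : ℕ → ℤ) (g : A → ℕ) (h : A → ℕ → ℕ) xs →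
    (∀ x → + g x ≡ sumTo n (λ q → c q * + h x q)) →
    + sumList g xs ≡ sumTo n (λ q → c q * + sumList (λ x → h x q) xs)
  +sumList≡sumTo n c g h []       g≡ = sym (sumTo-≡0 n (λ q _ → *-zeroʳ (c q)))
  +sumList≡sumTo n c g h (x ∷ xs) g≡ = begin
      + (g x ℕ.+ sumList g xs)
    ≡⟨ pos-+ (g x) (sumList g xs) ⟩
      + g x + + sumList g xs
    ≡⟨ cong₂ _+_ (g≡ x) (+sumList≡sumTo n c g h xs g≡) ⟩
      sumTo n (λ q → c q * + h x q) + sumTo n (λ q → c q * + sumList (λ y → h y q) xs)
    ≡⟨ sumTo-distrib-+ n (λ q → c q * + h x q) (λ q → c q * + sumList (λ y → h y q) xs) ⟨
      sumTo n (λ q → c q * + h x q + c q * + sumList (λ y → h y q) xs)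
    ≡⟨ sumTo-cong n (λ q _ → trans (sym (*-distribˡ-+ (c q) (+ h x q) _))
                                   (cong (c q *_) (sym (pos-+ (h x q) _)))) ⟩
      sumTo n (λ q → c q * + (h x q ℕ.+ sumList (λ y → h y q) xs))
    ∎
    where open ≡-Reasoning

  countWords≡sumTo-moment : ∀ n p →
    + countWords N n (desX isO) p ≡ sumTo n (λ q → signedBinom p q * + moment n q)
  countWords≡sumTo-moment n p = trans
    (cong +_ (length-filterᵇ (λ w → desX isO w ℕ.≡ᵇ p) (words N n)))
    (+sumList≡sumTo n (signedBinom p) (λ w → δ (desX isO w) p) (λ w → binom (desX isO w)) (words N n)
      (λ w → δ≡sumTo-signedBinom p (desX-≤ isO w)))

  alternatingTerm : ℕ → ℕ → ℕ → ℤ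
  alternatingTerm n j i = sign (j ℕ.+ i) * (+ binom j i * + binom (k ℕ.* i) n)

  +moment≡ : ∀ {n} j q → j ℕ.+ q ≡ n → + moment n q ≡ + (2 ^ j) * sumTo j (alternatingTerm n j)
  +moment≡ {n} j q j+q≡n = begin
      + moment n q
    ≡⟨ cong +_ (trans (moment≡runSeqs j q j+q≡n) (convPow-* 2 P j q)) ⟩
      + (2 ^ j ℕ.* convPow P j q)
    ≡⟨ pos-* (2 ^ j) (convPow P j q) ⟩
      + (2 ^ j) * + convPow P j q
    ≡⟨ cong (+ (2 ^ j) *_) inversion ⟨
      + (2 ^ j) * sumTo j (alternatingTerm n j)
    ∎
    where
    open ≡-Reasoning
    P = binom k ∘ suc
    n∸j≡q : n ∸ j ≡ q
    n∸j≡q = trans (cong (_∸ j) (sym j+q≡n)) (ℕ.m+n∸m≡n j q)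
    inversion : sumTo j (alternatingTerm n j) ≡ + convPow P j q
    inversion = trans
      (binomial-inversion (λ j′ → + convPow P j′ (n ∸ j′)) (λ i → + binom (k ℕ.* i) n)
        (subst (j ≤_) j+q≡n (ℕ.m≤m+n j q))
        (λ i → trans (cong +_ (binom[k*i]≡diagConv k i n)) (+diagConv≡sumTo (binom i) (convPow P) n)))
      (cong (+_ ∘ convPow P j) n∸j≡q)

  summand≡ : ∀ {n} p j i → j ≤ n →
    signedBinom p (n ∸ j) * (+ (2 ^ j) * alternatingTerm n j i)
      ≡ sign (n ℕ.+ p ℕ.+ i) * + (2 ^ j ℕ.* (j C i) ℕ.* ((k ℕ.* i) C n) ℕ.* ((n ∸ j) C p))
  summand≡ {n} p j i j≤n = begin
      sign (n ∸ j ℕ.+ p) * + binom (n ∸ j) p * (+ (2 ^ j) * alternatingTerm n j i)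
    ≡⟨ rearrange (sign (n ∸ j ℕ.+ p)) (sign (j ℕ.+ i)) (+ binom (n ∸ j) p) (+ (2 ^ j)) (+ binom j i) _ ⟩
      sign (n ∸ j ℕ.+ p) * sign (j ℕ.+ i)
        * (+ (2 ^ j) * + binom j i * + binom (k ℕ.* i) n * + binom (n ∸ j) p)
    ≡⟨ cong₂ _*_ signs (sym casts) ⟩
      sign (n ℕ.+ p ℕ.+ i) * + (2 ^ j ℕ.* (j C i) ℕ.* ((k ℕ.* i) C n) ℕ.* ((n ∸ j) C p))
    ∎
    where
    open ≡-Reasoning
    rearrange : ∀ s t c e a b → s * c * (e * (t * (a * b))) ≡ s * t * (e * a * b * c)
    rearrange = solve-∀
    regroup : ∀ a b c d → a ℕ.+ b ℕ.+ (c ℕ.+ d) ≡ a ℕ.+ c ℕ.+ b ℕ.+ d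
    regroup = ℕ.solve-∀
    signs : sign (n ∸ j ℕ.+ p) * sign (j ℕ.+ i) ≡ sign (n ℕ.+ p ℕ.+ i)
    signs = begin
        sign (n ∸ j ℕ.+ p) * sign (j ℕ.+ i)  ≡⟨ sign-+ (n ∸ j ℕ.+ p) (j ℕ.+ i) ⟨
        sign (n ∸ j ℕ.+ p ℕ.+ (j ℕ.+ i))     ≡⟨ cong sign (regroup (n ∸ j) p j i) ⟩
        sign (n ∸ j ℕ.+ j ℕ.+ p ℕ.+ i)       ≡⟨ cong (λ m → sign (m ℕ.+ p ℕ.+ i)) (ℕ.m∸n+n≡m j≤n) ⟩
        sign (n ℕ.+ p ℕ.+ i)                 ∎
    casts : + (2 ^ j ℕ.* (j C i) ℕ.* ((k ℕ.* i) C n) ℕ.* ((n ∸ j) C p))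
            ≡ + (2 ^ j) * + binom j i * + binom (k ℕ.* i) n * + binom (n ∸ j) p
    casts = begin
        + (2 ^ j ℕ.* (j C i) ℕ.* ((k ℕ.* i) C n) ℕ.* ((n ∸ j) C p))
      ≡⟨ cong +_ (cong₂ ℕ._*_ (cong₂ ℕ._*_ (cong (2 ^ j ℕ.*_) (binom≡C j i)) (binom≡C (k ℕ.* i) n))
                              (binom≡C (n ∸ j) p)) ⟨
        + (2 ^ j ℕ.* binom j i ℕ.* binom (k ℕ.* i) n ℕ.* binom (n ∸ j) p)
      ≡⟨ pos-* (2 ^ j ℕ.* binom j i ℕ.* binom (k ℕ.* i) n) (binom (n ∸ j) p) ⟩
        + (2 ^ j ℕ.* binom j i ℕ.* binom (k ℕ.* i) n) * + binom (n ∸ j) p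
      ≡⟨ cong (_* + binom (n ∸ j) p) (pos-* (2 ^ j ℕ.* binom j i) (binom (k ℕ.* i) n)) ⟩
        + (2 ^ j ℕ.* binom j i) * + binom (k ℕ.* i) n * + binom (n ∸ j) p
      ≡⟨ cong (λ x → x * + binom (k ℕ.* i) n * + binom (n ∸ j) p) (pos-* (2 ^ j) (binom j i)) ⟩
        + (2 ^ j) * + binom j i * + binom (k ℕ.* i) n * + binom (n ∸ j) p
      ∎

  moment-column≡ : ∀ {n} p j → j ≤ n →
    signedBinom p (n ∸ j) * + moment n (n ∸ j)
      ≡ sumTo j (λ i → sign (n ℕ.+ p ℕ.+ i) * + (2 ^ j ℕ.* (j C i) ℕ.* ((k ℕ.* i) C n) ℕ.* ((n ∸ j) C p)))
  moment-column≡ {n} p j j≤n = begin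
      c * + moment n (n ∸ j)
    ≡⟨ cong (c *_) (+moment≡ j (n ∸ j) (ℕ.m+[n∸m]≡n j≤n)) ⟩
      c * (+ (2 ^ j) * sumTo j (alternatingTerm n j))
    ≡⟨ cong (c *_) (*-distribˡ-sumTo j (+ (2 ^ j)) (alternatingTerm n j)) ⟩
      c * sumTo j (λ i → + (2 ^ j) * alternatingTerm n j i)
    ≡⟨ *-distribˡ-sumTo j c (λ i → + (2 ^ j) * alternatingTerm n j i) ⟩
      sumTo j (λ i → c * (+ (2 ^ j) * alternatingTerm n j i))
    ≡⟨ sumTo-cong j (λ i _ → summand≡ p j i j≤n) ⟩
      sumTo j (λ i → sign (n ℕ.+ p ℕ.+ i) * + (2 ^ j ℕ.* (j C i) ℕ.* ((k ℕ.* i) C n) ℕ.* ((n ∸ j) C p)))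
    ∎
    where
    open ≡-Reasoning
    c = signedBinom p (n ∸ j)

  countWords-desX≡formula : ∀ n p → + countWords N n (desX isO) p ≡ formula k n p
  countWords-desX≡formula n p = begin
      + countWords N n (desX isO) p
    ≡⟨ countWords≡sumTo-moment n p ⟩
      sumTo n (λ q → signedBinom p q * + moment n q)
    ≡⟨ sumTo-reverse n (λ q → signedBinom p q * + moment n q) ⟩
      sumTo n (λ j → signedBinom p (n ∸ j) * + moment n (n ∸ j))
    ≡⟨ sumTo-cong n (λ j j≤n → moment-column≡ p j j≤n) ⟩
      formula k n p
    ∎
    where open ≡-Reasoning

open import Data.Nat.Base using (_≥_; _*_)
open import Data.Integer.Base using (+_)
open import Data.Product.Base using (_×_; _,_)
open import Relation.Binary.PropositionalEquality using (_≡_; trans; cong)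
open import Defs

corollary5p3 : (k n p : ℕ) → k ≥ 1 →
    (+ countWords (2 * k) n (desX isO) p ≡ formula k n p) ×
    (+ countWords (2 * k) n (risX isE) p ≡ formula k n p)
corollary5p3 k n p _ =
    countWords-desX≡formula n p
  , trans (cong +_ (countWords-risX≡desX (even-2* k) n p)) (countWords-desX≡formula n p)
  where
  open DescentFormula k using (countWords-desX≡formula)
  open Complement using (countWords-risX≡desX)
  open Runs using (even-2*)
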